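{- Let $\mu_l$ be the number of mixed metatiles of length $l$ when tiling with half-squares, fences and combs. Then for every positive integer $l$, \[\mu_l=4(T_l+T_{l-1})-2\delta_{l,2}.\]
   Context: Tribonacci numbers: $T_n=T_{n-1}+T_{n-2}+T_{n-3}+\delta_{n,2}$ for all integers $n$, with $T_n=0$ for $n<2$ (so $T_2=T_3=1$, $T_4=2$, $T_5=4,\dots$); $\delta_{i,j}$ is $1$ if $i=j$ and $0$ otherwise. An $n$-board is a linear array of $n$ unit cells, each split into a left and a right slot of size $\frac12\times1$. A $(\frac12,\frac12;m)$-comb is a tile of $m$ teeth of size $\frac12\times1$ with consecutive teeth separated by gaps of size $\frac12\times1$; on a board it covers $m$ slots of the same kind (all left or all right) in $m$ consecutive cells, its gaps may be filled by other tiles. Half-squares, fences, combs are the cases $m=1,2,3$. A tiling covers each slot by exactly one tooth. A metatile of length $l$ is a tiling of an $l$-board such that for every $1\le j\le l-1$ some tile has teeth both in cells $1,\dots,j$ and in cells $j+1,\dots,l$. A metatile is mixed if it contains more than one of the three tile types. -}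

module Defs where

open import Data.Bool using (Bool; true; false; _∧_; _∨_; not; if_then_else_)
open import Data.Nat using (ℕ; zero; suc; _+_; _*_; _∸_; _<ᵇ_; _≡ᵇ_; _≤ᵇ_)
open import Data.Fin using (Fin; toℕ)
open import Data.Vec using (Vec; []; _∷_; lookup)
open import Data.List using (List; []; _∷_; length; filterᵇ; concatMap; map; allFin; upTo)
open import Data.Bool.ListAction using (all; any)
open import Data.Nat.ListAction using (sum)

Trib : ℕ → ℕ
Trib 0 = 0
Trib 1 = 0
Trib 2 = 1
Trib (suc (suc (suc n))) = Trib (suc (suc n)) + Trib (suc n) + Trib n

δ : ℕ → ℕ → ℕ
δ i j = if i ≡ᵇ j then 1 else 0

-- Tile types: half-square (m = 1), fence (m = 2), comb (m = 3),
-- encoded by Fin 3 (index k stands for m = k + 1 teeth).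
-- Sides: Fin 2 (0 = left slot, 1 = right slot).
teeth : Fin 3 → ℕ
teeth k = suc (toℕ k)

-- A set of tile placements on an n-board (cells numbered 0 … n-1):
-- entry [k][s][c] is true iff the set contains the tile of type k whose
-- teeth lie in the s-slots of cells c, c+1, …, c + teeth k - 1.
Placements : ℕ → Set
Placements n = Vec (Vec (Vec Bool n) 2) 3

chosen : ∀ {n} → Placements n → Fin 3 → Fin 2 → Fin n → Bool
chosen x k s c = lookup (lookup (lookup x k) s) c

allVecs : ∀ {A : Set} → List A → (k : ℕ) → List (Vec A k)
allVecs xs zero = [] ∷ []
allVecs xs (suc k) = concatMap (λ a → map (a ∷_) (allVecs xs k)) xs

allPlacements : (n : ℕ) → List (Placements n)
allPlacements n = allVecs (allVecs (allVecs (true ∷ false ∷ []) n) 2) 3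

hasToothIn : ∀ {n} → Fin 3 → Fin n → ℕ → Bool
hasToothIn k c j = (toℕ c ≤ᵇ j) ∧ (j <ᵇ toℕ c + teeth k)

anyTile : ∀ {n} → (Fin 3 → Fin 2 → Fin n → Bool) → Bool
anyTile {n} p = any (λ k → any (λ s → any (λ c → p k s c) (allFin n)) (allFin 2)) (allFin 3)

allTile : ∀ {n} → (Fin 3 → Fin 2 → Fin n → Bool) → Bool
allTile {n} p = all (λ k → all (λ s → all (λ c → p k s c) (allFin n)) (allFin 2)) (allFin 3)

coverCount : ∀ {n} → Placements n → Fin 2 → ℕ → ℕ
coverCount {n} x s j =
  sum (map (λ k → length (filterᵇ (λ c → chosen x k s c ∧ hasToothIn k c j) (allFin n))) (allFin 3))

isTiling : (n : ℕ) → Placements n → Bool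
isTiling n x =
  allTile (λ k s c → not (chosen x k s c) ∨ (toℕ c + teeth k ≤ᵇ n))
  ∧ all (λ j → all (λ s → coverCount x s j ≡ᵇ 1) (allFin 2)) (upTo n)

-- metatile of length l: a tiling such that for every 1 ≤ j ≤ l-1 some
-- tile has teeth both in cells 1..j and in cells j+1..l (1-indexed), i.e.
-- (0-indexed) some chosen tile with start c satisfies c < j < c + m.
isMetatile : (l : ℕ) → Placements l → Bool
isMetatile l x =
  isTiling l x
  ∧ all (λ j → (j ≡ᵇ 0) ∨ anyTile (λ k s c → chosen x k s c ∧ (toℕ c <ᵇ j) ∧ (j <ᵇ toℕ c + teeth k))) (upTo l)

isMixed : ∀ {n} → Placements n → Bool
isMixed x =
  anyTile (λ k s c → chosen x k s c ∧
    anyTile (λ k' s' c' → chosen x k' s' c' ∧ not (toℕ k ≡ᵇ toℕ k')))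

μ : ℕ → ℕ
μ l = length (filterᵇ (λ x → isMetatile l x ∧ isMixed x) (allPlacements l))

{-# OPTIONS --safe #-}
module Submission where

-- Scan a tiling from left to right. Everything the tiles met so far impose on the rest of the
-- board is a finite state: on each side, for how many further cells the tile straddling the
-- current cut still occupies that side (0, 1 or 2), and which tile types have occurred. So μ l
-- counts length-l paths of a finite automaton, i.e. it is given by powers of a transfer matrix.
-- Once at least three cells remain no tile can overrun the board, so the transfer step no
-- longer depends on the length; being linear, it propagates the Tribonacci recurrence from the
-- successor states to a state. A finite check over all states starts this induction, and the
-- values at lengths 1 to 6 pin down the solution.

open import Defs
open import Algebra.Core using (Op₂)
import Algebra.Structures as Structures
open import Data.Bool using (Bool; true; false; _∧_; _∨_; not; if_then_else_)
open import Data.Bool.Properties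
  using (∨-isCommutativeMonoid; ∧-isCommutativeMonoid; ∧-distribʳ-∨; ∧-assoc; ∨-assoc; ∧-zeroʳ; ∨-identityʳ; ∨-zeroʳ; ∧-conicalˡ; ∧-conicalʳ)
open import Data.Bool.ListAction using (all; any)
open import Data.Fin using (Fin; toℕ; zero; suc; inject₁)
open import Data.Fin.Properties using (all?)
open import Data.List using (List; []; _∷_; _++_; map; foldr; concatMap; length; filterᵇ; allFin; upTo)
open import Data.List.Properties using (map-cong; map-∘; map-tabulate; map-upTo)
open import Data.Nat using (ℕ; zero; suc; _+_; _*_; _∸_; _≤_; _<ᵇ_; _≡ᵇ_; _≤ᵇ_; _≟_)
open import Data.Nat.ListAction using (sum)
open import Data.Nat.Properties using (+-0-isCommutativeMonoid; +-identityʳ; +-assoc)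
open import Data.Product using (_×_; _,_; proj₁; proj₂)
open import Data.Vec using (Vec; []; _∷_; lookup; zipWith)
open import Data.Vec.Properties using (lookup-zipWith)
open import Data.Nat.Solver using (module +-*-Solver)
open import Function using (_∘_; id)
open import Relation.Binary.PropositionalEquality
open import Relation.Nullary.Decidable using (Dec; map′; _×-dec_; from-yes)

module BigOperator {A : Set} {_∙_ : Op₂ A} {ε : A}
                   (isCommutativeMonoid : Structures.IsCommutativeMonoid _≡_ _∙_ ε) where

  open Structures.IsCommutativeMonoid isCommutativeMonoid using (assoc; comm; identityˡ)
  open ≡-Reasoning

  ⨁ : {B : Set} → List B → (B → A) → A
  ⨁ xs f = foldr _∙_ ε (map f xs)

  interchange : ∀ a b c d → (a ∙ b) ∙ (c ∙ d) ≡ (a ∙ c) ∙ (b ∙ d)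
  interchange a b c d = begin
    (a ∙ b) ∙ (c ∙ d)  ≡⟨ assoc a b (c ∙ d) ⟩
    a ∙ (b ∙ (c ∙ d))  ≡⟨ cong (a ∙_) (sym (assoc b c d)) ⟩
    a ∙ ((b ∙ c) ∙ d)  ≡⟨ cong (λ t → a ∙ (t ∙ d)) (comm b c) ⟩
    a ∙ ((c ∙ b) ∙ d)  ≡⟨ cong (a ∙_) (assoc c b d) ⟩
    a ∙ (c ∙ (b ∙ d))  ≡⟨ sym (assoc a c (b ∙ d)) ⟩
    (a ∙ c) ∙ (b ∙ d)  ∎

  module _ {B : Set} where

    ⨁-cong : ∀ xs {f g : B → A} → (∀ x → f x ≡ g x) → ⨁ xs f ≡ ⨁ xs g
    ⨁-cong xs f≗g = cong (foldr _∙_ ε) (map-cong f≗g xs)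

    ⨁-ε : ∀ xs {f : B → A} → (∀ x → f x ≡ ε) → ⨁ xs f ≡ ε
    ⨁-ε []       f≗ε = refl
    ⨁-ε (x ∷ xs) f≗ε = trans (cong₂ _∙_ (f≗ε x) (⨁-ε xs f≗ε)) (identityˡ ε)

    ⨁-++ : ∀ xs ys (f : B → A) → ⨁ (xs ++ ys) f ≡ ⨁ xs f ∙ ⨁ ys f
    ⨁-++ []       ys f = sym (identityˡ (⨁ ys f))
    ⨁-++ (x ∷ xs) ys f = trans (cong (f x ∙_) (⨁-++ xs ys f)) (sym (assoc (f x) _ _))

    ⨁-distrib : ∀ xs (f g : B → A) → ⨁ xs (λ x → f x ∙ g x) ≡ ⨁ xs f ∙ ⨁ xs g
    ⨁-distrib []       f g = sym (identityˡ ε)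
    ⨁-distrib (x ∷ xs) f g =
      trans (cong ((f x ∙ g x) ∙_) (⨁-distrib xs f g)) (interchange (f x) (g x) _ _)

  module _ {B C : Set} where

    ⨁-map : ∀ (g : B → C) xs (f : C → A) → ⨁ (map g xs) f ≡ ⨁ xs (f ∘ g)
    ⨁-map g xs f = cong (foldr _∙_ ε) (sym (map-∘ xs))

    ⨁-concatMap : ∀ (g : B → List C) xs (f : C → A) →
                  ⨁ (concatMap g xs) f ≡ ⨁ xs (λ x → ⨁ (g x) f)
    ⨁-concatMap g []       f = refl
    ⨁-concatMap g (x ∷ xs) f =
      trans (⨁-++ (g x) (concatMap g xs) f) (cong (⨁ (g x) f ∙_) (⨁-concatMap g xs f))

    ⨁-comm : ∀ xs ys (F : B → C → A) →
             ⨁ xs (λ x → ⨁ ys (F x)) ≡ ⨁ ys (λ y → ⨁ xs (λ x → F x y))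
    ⨁-comm []       ys F = sym (⨁-ε ys (λ _ → refl))
    ⨁-comm (x ∷ xs) ys F = trans (cong (⨁ ys (F x) ∙_) (⨁-comm xs ys F))
                                 (sym (⨁-distrib ys (F x) (λ y → ⨁ xs (λ x → F x y))))

  ⨁-allFin-suc : ∀ n (f : Fin (suc n) → A) → ⨁ (allFin (suc n)) f ≡ f zero ∙ ⨁ (allFin n) (f ∘ suc)
  ⨁-allFin-suc n f = cong (λ fs → f zero ∙ foldr _∙_ ε fs)
    (trans (map-tabulate suc f) (sym (map-tabulate id (f ∘ suc))))

  ⨁-upTo-suc : ∀ n (f : ℕ → A) → ⨁ (upTo (suc n)) f ≡ f 0 ∙ ⨁ (upTo n) (f ∘ suc)
  ⨁-upTo-suc n f = cong (f 0 ∙_) (trans (cong (λ xs → ⨁ xs f) (sym (map-upTo suc n)))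
                                       (⨁-map suc (upTo n) f))

open BigOperator +-0-isCommutativeMonoid
  using ()
  renaming (⨁-cong to ∑-cong; ⨁-ε to ∑-zero; ⨁-distrib to ∑-+; ⨁-map to ∑-map;
            ⨁-concatMap to ∑-concatMap; ⨁-comm to ∑-comm; ⨁-allFin-suc to ∑-allFin-suc)
open BigOperator ∨-isCommutativeMonoid
  using ()
  renaming (⨁-cong to any-cong; ⨁-ε to any-false; ⨁-distrib to any-∨; ⨁-comm to any-comm;
            ⨁-allFin-suc to any-allFin-suc)
open BigOperator ∧-isCommutativeMonoid
  using ()
  renaming (⨁-cong to all-cong; ⨁-distrib to all-∧; interchange to ∧-interchange;
            ⨁-allFin-suc to all-allFin-suc; ⨁-upTo-suc to all-upTo-suc)

-- definitionally the ⨁ of (ℕ, +, 0), so the ∑-lemmas above apply to it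
∑ : {A : Set} → List A → (A → ℕ) → ℕ
∑ xs f = sum (map f xs)

syntax ∑ xs (λ x → e) = ∑[ x ← xs ] e

𝟙 : Bool → ℕ
𝟙 b = if b then 1 else 0

module _ {A : Set} where

  length-filterᵇ : ∀ (p : A → Bool) xs → length (filterᵇ p xs) ≡ ∑[ x ← xs ] 𝟙 (p x)
  length-filterᵇ p []       = refl
  length-filterᵇ p (x ∷ xs) with p x
  ... | true  = cong suc (length-filterᵇ p xs)
  ... | false = length-filterᵇ p xs

  ∑-𝟙-∧ˡ : ∀ b (p : A → Bool) xs → ∑[ x ← xs ] 𝟙 (b ∧ p x) ≡ (if b then ∑[ x ← xs ] 𝟙 (p x) else 0)
  ∑-𝟙-∧ˡ true  p xs = refl
  ∑-𝟙-∧ˡ false p xs = ∑-zero xs (λ _ → refl)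

  any-∧ʳ : ∀ (p : A → Bool) b xs → any (λ x → p x ∧ b) xs ≡ any p xs ∧ b
  any-∧ʳ p b []       = refl
  any-∧ʳ p b (x ∷ xs) = trans (cong ((p x ∧ b) ∨_) (any-∧ʳ p b xs)) (sym (∧-distribʳ-∨ b (p x) (any p xs)))

record Splits {A P Q : Set} (ys : List A) (g : P → Q → A) (ps : List P) (qs : List Q) : Set where
  field
    ∑-split : ∀ (f : A → ℕ) → ∑ ys f ≡ ∑[ p ← ps ] ∑[ q ← qs ] f (g p q)
open Splits

allVecs-suc-splits : {A : Set} (xs : List A) (k : ℕ) → Splits (allVecs xs (suc k)) _∷_ xs (allVecs xs k)
allVecs-suc-splits xs k .∑-split f = trans (∑-concatMap (λ a → map (a ∷_) (allVecs xs k)) xs f)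
                                           (∑-cong xs (λ a → ∑-map (a ∷_) (allVecs xs k) f))

allVecs-zipWith-splits : {A P Q : Set} {ys : List A} {g : P → Q → A} {ps : List P} {qs : List Q} →
                         Splits ys g ps qs →
                         ∀ k → Splits (allVecs ys k) (zipWith g) (allVecs ps k) (allVecs qs k)
allVecs-zipWith-splits ys-splits zero .∑-split f = cong (_+ 0) (sym (+-identityʳ (f [])))
allVecs-zipWith-splits {ys = ys} {g} {ps} {qs} ys-splits (suc k) .∑-split F = begin
  ∑ (allVecs ys (suc k)) F
    ≡⟨ allVecs-suc-splits ys k .∑-split F ⟩
  ∑[ y ← ys ] ∑[ v ← allVecs ys k ] F (y ∷ v)
    ≡⟨ ys-splits .∑-split _ ⟩
  ∑[ p ← ps ] ∑[ q ← qs ] ∑[ v ← allVecs ys k ] F (g p q ∷ v)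
    ≡⟨ ∑-cong ps (λ p → ∑-cong qs (λ q → allVecs-zipWith-splits ys-splits k .∑-split _)) ⟩
  ∑[ p ← ps ] ∑[ q ← qs ] ∑[ u ← allVecs ps k ] ∑[ w ← allVecs qs k ] F (zipWith g (p ∷ u) (q ∷ w))
    ≡⟨ ∑-cong ps (λ p → ∑-comm qs (allVecs ps k) _) ⟩
  ∑[ p ← ps ] ∑[ u ← allVecs ps k ] ∑[ q ← qs ] ∑[ w ← allVecs qs k ] F (zipWith g (p ∷ u) (q ∷ w))
    ≡⟨ ∑-cong ps (λ p → ∑-cong (allVecs ps k) (λ u → sym (allVecs-suc-splits qs k .∑-split _))) ⟩
  ∑[ p ← ps ] ∑[ u ← allVecs ps k ] ∑[ w ← allVecs qs (suc k) ] F (zipWith g (p ∷ u) w)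
    ≡⟨ sym (allVecs-suc-splits ps k .∑-split _) ⟩
  ∑[ u ← allVecs ps (suc k) ] ∑[ w ← allVecs qs (suc k) ] F (zipWith g u w) ∎
  where open ≡-Reasoning

-- the first column of a placement: which tiles start in its first cell
Heads : Set
Heads = Vec (Vec Bool 2) 3

allHeads : List Heads
allHeads = allVecs (allVecs (true ∷ false ∷ []) 2) 3

infixr 5 _◂_
_◂_ : ∀ {n} → Heads → Placements n → Placements (suc n)
h ◂ x = zipWith (zipWith _∷_) h x

allPlacements-splits : ∀ n → Splits (allPlacements (suc n)) _◂_ allHeads (allPlacements n)
allPlacements-splits n =
  allVecs-zipWith-splits (allVecs-zipWith-splits (allVecs-suc-splits (true ∷ false ∷ []) n) 2) 3

-- What a placement to the right of a cut inherits from the tiles left of it: the number of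
-- their teeth in slot s of cell j, whether the cut before cell j is already crossed (or needs
-- no crossing), and which tile types occur.
record Boundary : Set where
  field
    covered  : Fin 2 → ℕ → ℕ
    bridged  : ℕ → Bool
    typeUsed : Fin 3 → Bool
open Boundary

leftEnd : Boundary
leftEnd = record { covered = λ _ _ → 0 ; bridged = λ j → j ≡ᵇ 0 ; typeUsed = λ _ → false }

allTypeSide anyTypeSide : (Fin 3 → Fin 2 → Bool) → Bool
allTypeSide p = all (λ k → all (p k) (allFin 2)) (allFin 3)
anyTypeSide p = any (λ k → any (p k) (allFin 2)) (allFin 3)

module _ {p q : Fin 3 → Fin 2 → Bool} where

  allTypeSide-cong : (∀ k s → p k s ≡ q k s) → allTypeSide p ≡ allTypeSide q
  allTypeSide-cong p≗q = all-cong (allFin 3) (λ k → all-cong (allFin 2) (p≗q k))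

  anyTypeSide-cong : (∀ k s → p k s ≡ q k s) → anyTypeSide p ≡ anyTypeSide q
  anyTypeSide-cong p≗q = any-cong (allFin 3) (λ k → any-cong (allFin 2) (p≗q k))

allTypeSide-∧ : ∀ p q → allTypeSide (λ k s → p k s ∧ q k s) ≡ allTypeSide p ∧ allTypeSide q
allTypeSide-∧ p q = trans (all-cong (allFin 3) (λ k → all-∧ (allFin 2) (p k) (q k)))
                          (all-∧ (allFin 3) (λ k → all (p k) (allFin 2)) (λ k → all (q k) (allFin 2)))

anyTypeSide-∨ : ∀ p q → anyTypeSide (λ k s → p k s ∨ q k s) ≡ anyTypeSide p ∨ anyTypeSide q
anyTypeSide-∨ p q = trans (any-cong (allFin 3) (λ k → any-∨ (allFin 2) (p k) (q k)))
                          (any-∨ (allFin 3) (λ k → any (p k) (allFin 2)) (λ k → any (q k) (allFin 2)))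

anyTypeSide-false : ∀ p → (∀ k s → p k s ≡ false) → anyTypeSide p ≡ false
anyTypeSide-false p p≗false = any-false (allFin 3) (λ k → any-false (allFin 2) (p≗false k))

atLeastTwo : (Fin 3 → Bool) → Bool
atLeastTwo u = (u zero ∧ u (suc zero)) ∨ (u zero ∧ u (suc (suc zero))) ∨ (u (suc zero) ∧ u (suc (suc zero)))

module _ {n : ℕ} where

  fitsIn : Placements n → Bool
  fitsIn x = allTile (λ k s c → not (chosen x k s c) ∨ (toℕ c + teeth k ≤ᵇ n))

  coversExactly : Boundary → Placements n → Bool
  coversExactly β x = all (λ j → all (λ s → covered β s j + coverCount x s j ≡ᵇ 1) (allFin 2)) (upTo n)

  crosses : Placements n → ℕ → Bool
  crosses x j = anyTile (λ k s c → chosen x k s c ∧ (toℕ c <ᵇ j) ∧ (j <ᵇ toℕ c + teeth k))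

  bridgesCuts : Boundary → Placements n → Bool
  bridgesCuts β x = all (λ j → bridged β j ∨ crosses x j) (upTo n)

  usesType : Placements n → Fin 3 → Bool
  usesType x k = any (λ s → any (chosen x k s) (allFin n)) (allFin 2)

  Admissible : Boundary → Placements n → Bool
  Admissible β x = fitsIn x ∧ coversExactly β x ∧ bridgesCuts β x
                   ∧ atLeastTwo (λ k → typeUsed β k ∨ usesType x k)

atLeastTwo-cong : {u v : Fin 3 → Bool} → (∀ k → u k ≡ v k) → atLeastTwo u ≡ atLeastTwo v
atLeastTwo-cong u≗v =
  cong₂ _∨_ (cong₂ _∧_ (u≗v zero) (u≗v (suc zero)))
            (cong₂ _∨_ (cong₂ _∧_ (u≗v zero) (u≗v (suc (suc zero))))
                       (cong₂ _∧_ (u≗v (suc zero)) (u≗v (suc (suc zero)))))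

anyOther≡atLeastTwo : ∀ a b c → let u = lookup (a ∷ b ∷ c ∷ []) in
  any (λ k → u k ∧ any (λ k′ → u k′ ∧ not (toℕ k ≡ᵇ toℕ k′)) (allFin 3)) (allFin 3) ≡ atLeastTwo u
anyOther≡atLeastTwo true  true  c     = refl
anyOther≡atLeastTwo true  false true  = refl
anyOther≡atLeastTwo true  false false = refl
anyOther≡atLeastTwo false true  true  = refl
anyOther≡atLeastTwo false true  false = refl
anyOther≡atLeastTwo false false true  = refl
anyOther≡atLeastTwo false false false = refl

isMixed≡atLeastTwo : ∀ {n} (x : Placements n) → isMixed x ≡ atLeastTwo (usesType x)
isMixed≡atLeastTwo {n} x = begin
  isMixed x
    ≡⟨ any-cong (allFin 3) (λ k → factor k (other k)) ⟩
  any (λ k → usesType x k ∧ other k) (allFin 3)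
    ≡⟨ any-cong (allFin 3) (λ k → cong (usesType x k ∧_) (any-cong (allFin 3) (λ k′ → factor k′ (not (toℕ k ≡ᵇ toℕ k′))))) ⟩
  any (λ k → usesType x k ∧ any (λ k′ → usesType x k′ ∧ not (toℕ k ≡ᵇ toℕ k′)) (allFin 3)) (allFin 3)
    ≡⟨ anyOther≡atLeastTwo (usesType x zero) (usesType x (suc zero)) (usesType x (suc (suc zero))) ⟩
  atLeastTwo (usesType x) ∎
  where
  open ≡-Reasoning
  other : Fin 3 → Bool
  other k = anyTile (λ k′ s′ c′ → chosen x k′ s′ c′ ∧ not (toℕ k ≡ᵇ toℕ k′))
  factor : ∀ k b → any (λ s → any (λ c → chosen x k s c ∧ b) (allFin n)) (allFin 2) ≡ usesType x k ∧ b
  factor k b = trans (any-cong (allFin 2) (λ s → any-∧ʳ (chosen x k s) b (allFin n)))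
                     (any-∧ʳ (λ s → any (chosen x k s) (allFin n)) b (allFin 2))

metatile-mixed≡admissible : ∀ l (x : Placements l) → (isMetatile l x ∧ isMixed x) ≡ Admissible leftEnd x
metatile-mixed≡admissible l x =
  trans (cong (isMetatile l x ∧_) (isMixed≡atLeastTwo x))
        (trans (∧-assoc (fitsIn x ∧ coversExactly leftEnd x) _ _) (∧-assoc (fitsIn x) _ _))

startsAt : Heads → Fin 3 → Fin 2 → Bool
startsAt h k s = lookup (lookup h k) s

column : Heads → Fin 2 → Fin 3 → Bool
column h s k = startsAt h k s

teethAt : (Fin 3 → Bool) → ℕ → ℕ
teethAt b j = ∑[ k ← allFin 3 ] 𝟙 (b k ∧ (j <ᵇ teeth k))

reaches : (Fin 3 → Bool) → ℕ → Bool
reaches b j = any (λ k → b k ∧ (j <ᵇ teeth k)) (allFin 3)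

headFits : Heads → ℕ → Bool
headFits h n = allTypeSide (λ k s → not (startsAt h k s) ∨ (teeth k ≤ᵇ n))

headCoversCell₀ : Boundary → Heads → Bool
headCoversCell₀ β h = all (λ s → covered β s 0 + teethAt (column h s) 0 ≡ᵇ 1) (allFin 2)

headAdmissible : Boundary → Heads → ℕ → Bool
headAdmissible β h n = headFits h n ∧ headCoversCell₀ β h ∧ bridged β 0

shift : Boundary → Heads → Boundary
shift β h = record
  { covered  = λ s j → covered β s (suc j) + teethAt (column h s) (suc j)
  ; bridged  = λ j → bridged β (suc j) ∨ anyTypeSide (λ k s → startsAt h k s ∧ (suc j <ᵇ teeth k))
  ; typeUsed = λ k → typeUsed β k ∨ any (startsAt h k) (allFin 2)
  }

<ᵇ-suc : ∀ m n → (m <ᵇ suc n) ≡ (m ≤ᵇ n)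
<ᵇ-suc zero    n = refl
<ᵇ-suc (suc m) n = refl

hasToothIn-suc : ∀ {n} k (c : Fin n) j → hasToothIn k (suc c) (suc j) ≡ hasToothIn k c j
hasToothIn-suc k c j = cong (_∧ (j <ᵇ toℕ c + teeth k)) (<ᵇ-suc (toℕ c) j)

coverCount≡∑ : ∀ {n} (x : Placements n) s j →
               coverCount x s j ≡ ∑[ k ← allFin 3 ] ∑[ c ← allFin n ] 𝟙 (chosen x k s c ∧ hasToothIn k c j)
coverCount≡∑ {n} x s j = ∑-cong (allFin 3) (λ k → length-filterᵇ (λ c → chosen x k s c ∧ hasToothIn k c j) (allFin n))

module _ {n : ℕ} (h : Heads) (x : Placements n) where

  row-◂ : ∀ k s → lookup (lookup (h ◂ x) k) s ≡ startsAt h k s ∷ lookup (lookup x k) s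
  row-◂ k s = trans (cong (λ r → lookup r s) (lookup-zipWith (zipWith _∷_) k h x))
                    (lookup-zipWith _∷_ s (lookup h k) (lookup x k))

  chosen-◂-zero : ∀ k s → chosen (h ◂ x) k s zero ≡ startsAt h k s
  chosen-◂-zero k s = cong (λ r → lookup r zero) (row-◂ k s)

  chosen-◂-suc : ∀ k s c → chosen (h ◂ x) k s (suc c) ≡ chosen x k s c
  chosen-◂-suc k s c = cong (λ r → lookup r (suc c)) (row-◂ k s)

  fitsIn-◂ : fitsIn (h ◂ x) ≡ headFits h (suc n) ∧ fitsIn x
  fitsIn-◂ = trans (allTypeSide-cong {q = λ k s → headFit k s ∧ tailFit k s} split)
                   (allTypeSide-∧ headFit tailFit)
    where
    headFit tailFit : Fin 3 → Fin 2 → Bool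
    headFit k s = not (startsAt h k s) ∨ (teeth k ≤ᵇ suc n)
    tailFit k s = all (λ c → not (chosen x k s c) ∨ (toℕ c + teeth k ≤ᵇ n)) (allFin n)
    split : ∀ k s → all (λ c → not (chosen (h ◂ x) k s c) ∨ (toℕ c + teeth k ≤ᵇ suc n)) (allFin (suc n))
                    ≡ headFit k s ∧ tailFit k s
    split k s = trans (all-allFin-suc n (λ c → not (chosen (h ◂ x) k s c) ∨ (toℕ c + teeth k ≤ᵇ suc n)))
                      (cong₂ _∧_ (cong (λ b → not b ∨ (teeth k ≤ᵇ suc n)) (chosen-◂-zero k s))
                                 (all-cong (allFin n) λ c → cong₂ (λ b t → not b ∨ t)
                                    (chosen-◂-suc k s c) (<ᵇ-suc (toℕ c + teeth k) n)))

  coverCount-◂ : ∀ s j → coverCount (h ◂ x) s j ≡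
    teethAt (column h s) j + ∑[ k ← allFin 3 ] ∑[ c ← allFin n ] 𝟙 (chosen x k s c ∧ hasToothIn k (suc c) j)
  coverCount-◂ s j = trans (coverCount≡∑ (h ◂ x) s j) (trans (∑-cong (allFin 3) split)
    (∑-+ (allFin 3) (λ k → 𝟙 (startsAt h k s ∧ (j <ᵇ teeth k)))
                    (λ k → ∑[ c ← allFin n ] 𝟙 (chosen x k s c ∧ hasToothIn k (suc c) j))))
    where
    split : ∀ k → ∑[ c ← allFin (suc n) ] 𝟙 (chosen (h ◂ x) k s c ∧ hasToothIn k c j)
                  ≡ 𝟙 (startsAt h k s ∧ (j <ᵇ teeth k)) + ∑[ c ← allFin n ] 𝟙 (chosen x k s c ∧ hasToothIn k (suc c) j)
    split k = trans (∑-allFin-suc n (λ c → 𝟙 (chosen (h ◂ x) k s c ∧ hasToothIn k c j)))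
                    (cong₂ _+_ (cong (λ b → 𝟙 (b ∧ (j <ᵇ teeth k))) (chosen-◂-zero k s))
                               (∑-cong (allFin n) λ c → cong (λ b → 𝟙 (b ∧ hasToothIn k (suc c) j)) (chosen-◂-suc k s c)))

  coverCount-◂-zero : ∀ s → coverCount (h ◂ x) s 0 ≡ teethAt (column h s) 0
  coverCount-◂-zero s = trans (coverCount-◂ s 0) (trans (cong (teethAt (column h s) 0 +_) tail≡0) (+-identityʳ _))
    where
    tail≡0 : ∑[ k ← allFin 3 ] ∑[ c ← allFin n ] 𝟙 (chosen x k s c ∧ false) ≡ 0
    tail≡0 = ∑-zero (allFin 3) λ k → ∑-zero (allFin n) λ c → cong 𝟙 (∧-zeroʳ (chosen x k s c))

  coverCount-◂-suc : ∀ s j → coverCount (h ◂ x) s (suc j) ≡ teethAt (column h s) (suc j) + coverCount x s j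
  coverCount-◂-suc s j = trans (coverCount-◂ s (suc j)) (cong (teethAt (column h s) (suc j) +_)
    (trans (∑-cong (allFin 3) λ k → ∑-cong (allFin n) λ c → cong (λ b → 𝟙 (chosen x k s c ∧ b)) (hasToothIn-suc k c j))
           (sym (coverCount≡∑ x s j))))

  coversExactly-◂ : ∀ β → coversExactly β (h ◂ x) ≡ headCoversCell₀ β h ∧ coversExactly (shift β h) x
  coversExactly-◂ β = trans (all-upTo-suc n _) (cong₂ _∧_
    (all-cong (allFin 2) λ s → cong (λ t → covered β s 0 + t ≡ᵇ 1) (coverCount-◂-zero s))
    (all-cong (upTo n) λ j → all-cong (allFin 2) λ s → cong (_≡ᵇ 1)
      (trans (cong (covered β s (suc j) +_) (coverCount-◂-suc s j)) (sym (+-assoc (covered β s (suc j)) (teethAt (column h s) (suc j)) (coverCount x s j))))))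

  crosses-◂ : ∀ j → crosses (h ◂ x) j ≡
    anyTypeSide (λ k s → startsAt h k s ∧ (0 <ᵇ j) ∧ (j <ᵇ teeth k)) ∨
    anyTypeSide (λ k s → any (λ c → chosen x k s c ∧ (suc (toℕ c) <ᵇ j) ∧ (j <ᵇ suc (toℕ c + teeth k))) (allFin n))
  crosses-◂ j = trans (anyTypeSide-cong split) (anyTypeSide-∨ headPart tailPart)
    where
    headPart tailPart : Fin 3 → Fin 2 → Bool
    headPart k s = startsAt h k s ∧ (0 <ᵇ j) ∧ (j <ᵇ teeth k)
    tailPart k s = any (λ c → chosen x k s c ∧ (suc (toℕ c) <ᵇ j) ∧ (j <ᵇ suc (toℕ c + teeth k))) (allFin n)
    split : ∀ k s → any (λ c → chosen (h ◂ x) k s c ∧ (toℕ c <ᵇ j) ∧ (j <ᵇ toℕ c + teeth k)) (allFin (suc n)) ≡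
      (startsAt h k s ∧ (0 <ᵇ j) ∧ (j <ᵇ teeth k)) ∨
      any (λ c → chosen x k s c ∧ (suc (toℕ c) <ᵇ j) ∧ (j <ᵇ suc (toℕ c + teeth k))) (allFin n)
    split k s = trans (any-allFin-suc n _)
      (cong₂ _∨_ (cong (λ b → b ∧ (0 <ᵇ j) ∧ (j <ᵇ teeth k)) (chosen-◂-zero k s))
                 (any-cong (allFin n) λ c → cong (λ b → b ∧ _) (chosen-◂-suc k s c)))

  crosses-◂-zero : crosses (h ◂ x) 0 ≡ false
  crosses-◂-zero = trans (crosses-◂ 0) (cong₂ _∨_
    (anyTypeSide-false _ λ k s → ∧-zeroʳ (startsAt h k s))
    (anyTypeSide-false _ λ k s → any-false (allFin n) λ c → ∧-zeroʳ (chosen x k s c)))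

  bridgesCuts-◂ : ∀ β → bridgesCuts β (h ◂ x) ≡ bridged β 0 ∧ bridgesCuts (shift β h) x
  bridgesCuts-◂ β = trans (all-upTo-suc n _) (cong₂ _∧_
    (trans (cong (bridged β 0 ∨_) crosses-◂-zero) (∨-identityʳ _))
    (all-cong (upTo n) λ j → trans (cong (bridged β (suc j) ∨_) (crosses-◂ (suc j)))
      (sym (∨-assoc (bridged β (suc j)) (anyTypeSide (λ k s → startsAt h k s ∧ (suc j <ᵇ teeth k))) (crosses x j)))))

  usesType-◂ : ∀ k → usesType (h ◂ x) k ≡ any (startsAt h k) (allFin 2) ∨ usesType x k
  usesType-◂ k = trans (any-cong (allFin 2) λ s → trans (any-allFin-suc n (chosen (h ◂ x) k s))
                          (cong₂ _∨_ (chosen-◂-zero k s) (any-cong (allFin n) (chosen-◂-suc k s))))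
                       (any-∨ (allFin 2) (startsAt h k) (λ s → any (chosen x k s) (allFin n)))

  admissible-◂ : ∀ β → Admissible β (h ◂ x) ≡ headAdmissible β h (suc n) ∧ Admissible (shift β h) x
  admissible-◂ β = trans
    (cong₂ _∧_ fitsIn-◂ (cong₂ _∧_ (coversExactly-◂ β) (cong₂ _∧_ (bridgesCuts-◂ β)
      (atLeastTwo-cong λ k → trans (cong (typeUsed β k ∨_) (usesType-◂ k))
                                   (sym (∨-assoc (typeUsed β k) (any (startsAt h k) (allFin 2)) (usesType x k)))))))
    (regroup (headFits h (suc n)) (headCoversCell₀ β h) (bridged β 0) (fitsIn x) (coversExactly (shift β h) x)
             (bridgesCuts (shift β h) x) (atLeastTwo (λ k → typeUsed (shift β h) k ∨ usesType x k)))
    where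
    regroup : ∀ a b c d e f g → (a ∧ d) ∧ (b ∧ e) ∧ (c ∧ f) ∧ g ≡ (a ∧ b ∧ c) ∧ (d ∧ e ∧ f ∧ g)
    regroup a b c d e f g =
      trans (cong ((a ∧ d) ∧_) (trans (cong ((b ∧ e) ∧_) (∧-assoc c f g)) (∧-interchange b e c (f ∧ g))))
            (∧-interchange a d (b ∧ c) (e ∧ f ∧ g))

admissibleCount : ℕ → Boundary → ℕ
admissibleCount n β = ∑[ x ← allPlacements n ] 𝟙 (Admissible β x)

μ≡admissibleCount : ∀ l → μ l ≡ admissibleCount l leftEnd
μ≡admissibleCount l = trans (length-filterᵇ (λ x → isMetatile l x ∧ isMixed x) (allPlacements l))
                            (∑-cong (allPlacements l) λ x → cong 𝟙 (metatile-mixed≡admissible l x))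

admissibleCount-zero : ∀ β → admissibleCount 0 β ≡ 𝟙 (atLeastTwo (typeUsed β))
admissibleCount-zero β = trans (+-identityʳ _) (cong 𝟙 (atLeastTwo-cong λ k → ∨-identityʳ (typeUsed β k)))

admissibleCount-suc : ∀ n β → admissibleCount (suc n) β ≡
  ∑[ h ← allHeads ] (if headAdmissible β h (suc n) then admissibleCount n (shift β h) else 0)
admissibleCount-suc n β =
  trans (allPlacements-splits n .∑-split (λ x → 𝟙 (Admissible β x)))
        (∑-cong allHeads λ h →
           trans (∑-cong (allPlacements n) λ x → cong 𝟙 (admissible-◂ h x β))
                 (∑-𝟙-∧ˡ (headAdmissible β h (suc n)) (Admissible (shift β h)) (allPlacements n)))

record _≈_ (β γ : Boundary) : Set where
  field
    covered-≈  : ∀ s j → covered β s j ≡ covered γ s j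
    bridged-≈  : ∀ j → bridged β j ≡ bridged γ j
    typeUsed-≈ : ∀ k → typeUsed β k ≡ typeUsed γ k

admissibleCount-≈ : ∀ n {β γ} → β ≈ γ → admissibleCount n β ≡ admissibleCount n γ
admissibleCount-≈ n β≈γ = ∑-cong (allPlacements n) λ x → cong 𝟙 (cong₂ (λ c d → fitsIn x ∧ c ∧ d)
  (all-cong (upTo n) λ j → all-cong (allFin 2) λ s → cong (λ t → t + coverCount x s j ≡ᵇ 1) (covered-≈ s j))
  (cong₂ _∧_ (all-cong (upTo n) λ j → cong (_∨ crosses x j) (bridged-≈ j))
             (atLeastTwo-cong λ k → cong (_∨ usesType x k) (typeUsed-≈ k))))
  where open _≈_ β≈γ

-- The boundaries met when scanning a tiling from left to right: the tile straddling the cut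
-- on side s still occupies that side in the next overhang s cells.
record State : Set where
  constructor state
  field
    overhang₀ overhang₁ : Fin 3
    atLeftEnd           : Bool
    used₀ used₁ used₂   : Bool
open State

overhang : State → Fin 2 → Fin 3
overhang a zero    = overhang₀ a
overhang a (suc _) = overhang₁ a

used : State → Fin 3 → Bool
used a zero          = used₀ a
used a (suc zero)    = used₁ a
used a (suc (suc _)) = used₂ a

⟦_⟧ : State → Boundary
⟦ a ⟧ = record
  { covered  = λ s j → 𝟙 (j <ᵇ toℕ (overhang a s))
  ; bridged  = λ j → (atLeftEnd a ∧ (j ≡ᵇ 0)) ∨ any (λ s → j <ᵇ toℕ (overhang a s)) (allFin 2)
  ; typeUsed = used a
  }

start : State
start = state zero zero true false false false

leftEnd≈⟦start⟧ : leftEnd ≈ ⟦ start ⟧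
leftEnd≈⟦start⟧ = record
  { covered-≈  = λ { zero j → refl ; (suc zero) j → refl }
  ; bridged-≈  = λ j → sym (∨-identityʳ (j ≡ᵇ 0))
  ; typeUsed-≈ = λ { zero → refl ; (suc zero) → refl ; (suc (suc zero)) → refl }
  }

-- bₖ: a tile of type k starts on this side in the current cell. When nothing overhangs into
-- the cell exactly one bₖ holds, and that tile, having k + 1 teeth, overhangs k further cells.
nextOverhang : Fin 3 → Bool → Bool → Bool → Fin 3
nextOverhang zero    b₀ b₁ b₂ = if b₀ then zero else if b₁ then suc zero else suc (suc zero)
nextOverhang (suc o) _  _  _  = inject₁ o

nextOverhangOn : State → Heads → Fin 2 → Fin 3
nextOverhangOn a h s =
  nextOverhang (overhang a s) (startsAt h zero s) (startsAt h (suc zero) s) (startsAt h (suc (suc zero)) s)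

next : State → Heads → State
next a h = state (nextOverhangOn a h zero) (nextOverhangOn a h (suc zero)) false
                 (used₀ a ∨ any (startsAt h zero) (allFin 2))
                 (used₁ a ∨ any (startsAt h (suc zero)) (allFin 2))
                 (used₂ a ∨ any (startsAt h (suc (suc zero))) (allFin 2))

side-shift : ∀ o b₀ b₁ b₂ → let b = lookup (b₀ ∷ b₁ ∷ b₂ ∷ []) ; o′ = toℕ (nextOverhang o b₀ b₁ b₂) in
  (𝟙 (0 <ᵇ toℕ o) + teethAt b 0 ≡ᵇ 1) ≡ true → ∀ j →
  (𝟙 (suc j <ᵇ toℕ o) + teethAt b (suc j) ≡ 𝟙 (j <ᵇ o′)) × ((suc j <ᵇ toℕ o) ∨ reaches b (suc j) ≡ (j <ᵇ o′))
side-shift zero    true  true  _     ()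
side-shift zero    true  false true  ()
side-shift zero    false true  true  ()
side-shift zero    false false false ()
side-shift (suc _) true  _     _     ()
side-shift (suc _) false true  _     ()
side-shift (suc _) false false true  ()
side-shift zero             true  false false _ j             = refl , refl
side-shift zero             false true  false _ zero          = refl , refl
side-shift zero             false true  false _ (suc j)       = refl , refl
side-shift zero             false false true  _ zero          = refl , refl
side-shift zero             false false true  _ (suc zero)    = refl , refl
side-shift zero             false false true  _ (suc (suc j)) = refl , refl
side-shift (suc zero)       false false false _ j             = refl , refl
side-shift (suc (suc zero)) false false false _ zero          = refl , refl
side-shift (suc (suc zero)) false false false _ (suc j)       = refl , refl

shift-⟦⟧ : ∀ a h → headCoversCell₀ ⟦ a ⟧ h ≡ true → shift ⟦ a ⟧ h ≈ ⟦ next a h ⟧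
shift-⟦⟧ a h cell₀ = record
  { covered-≈  = λ { zero j → proj₁ (side zero j) ; (suc zero) j → proj₁ (side (suc zero) j) }
  ; bridged-≈  = bridged-≈
  ; typeUsed-≈ = λ { zero → refl ; (suc zero) → refl ; (suc (suc zero)) → refl }
  }
  where
  coversCell₀On : Fin 2 → Bool
  coversCell₀On s = covered ⟦ a ⟧ s 0 + teethAt (column h s) 0 ≡ᵇ 1
  coversSide : ∀ s → coversCell₀On s ≡ true
  coversSide zero       = ∧-conicalˡ (coversCell₀On zero) _ cell₀
  coversSide (suc zero) = ∧-conicalˡ (coversCell₀On (suc zero)) true (∧-conicalʳ (coversCell₀On zero) _ cell₀)
  pending : ℕ → Fin 2 → Bool
  pending j s = j <ᵇ toℕ (overhang a s)
  side : ∀ s j → (covered ⟦ a ⟧ s (suc j) + teethAt (column h s) (suc j) ≡ 𝟙 (j <ᵇ toℕ (nextOverhangOn a h s)))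
               × (pending (suc j) s ∨ reaches (column h s) (suc j) ≡ (j <ᵇ toℕ (nextOverhangOn a h s)))
  side s = side-shift (overhang a s) (startsAt h zero s) (startsAt h (suc zero) s) (startsAt h (suc (suc zero)) s)
                      (coversSide s)
  bridged-≈ : ∀ j → bridged (shift ⟦ a ⟧ h) j ≡ bridged ⟦ next a h ⟧ j
  bridged-≈ j = begin
    ((atLeftEnd a ∧ false) ∨ any (pending (suc j)) (allFin 2)) ∨ anyTypeSide (λ k s → startsAt h k s ∧ (suc j <ᵇ teeth k))
      ≡⟨ cong₂ _∨_ (cong (_∨ any (pending (suc j)) (allFin 2)) (∧-zeroʳ (atLeftEnd a)))
                   (any-comm (allFin 3) (allFin 2) (λ k s → startsAt h k s ∧ (suc j <ᵇ teeth k))) ⟩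
    any (pending (suc j)) (allFin 2) ∨ any (λ s → reaches (column h s) (suc j)) (allFin 2)
      ≡⟨ sym (any-∨ (allFin 2) (pending (suc j)) (λ s → reaches (column h s) (suc j))) ⟩
    any (λ s → pending (suc j) s ∨ reaches (column h s) (suc j)) (allFin 2)
      ≡⟨ any-cong (allFin 2) (λ s → proj₂ (side s j)) ⟩
    any (λ s → j <ᵇ toℕ (nextOverhangOn a h s)) (allFin 2)
      ≡⟨⟩
    bridged ⟦ next a h ⟧ j ∎
    where open ≡-Reasoning

-- opaque, so that only the numerical checks below evaluate it
opaque
  paths : ℕ → State → ℕ
  paths zero    a = 𝟙 (atLeastTwo (used a))
  paths (suc n) a = ∑[ h ← allHeads ] (if headAdmissible ⟦ a ⟧ h (suc n) then paths n (next a h) else 0)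

opaque
  unfolding paths

  paths-zero : ∀ a → paths zero a ≡ 𝟙 (atLeastTwo (used a))
  paths-zero a = refl

  paths-suc : ∀ n a → paths (suc n) a ≡
    ∑[ h ← allHeads ] (if headAdmissible ⟦ a ⟧ h (suc n) then paths n (next a h) else 0)
  paths-suc n a = refl

admissibleCount-⟦⟧ : ∀ n a → admissibleCount n ⟦ a ⟧ ≡ paths n a
admissibleCount-⟦⟧ zero    a = trans (admissibleCount-zero ⟦ a ⟧) (sym (paths-zero a))
admissibleCount-⟦⟧ (suc n) a =
  trans (admissibleCount-suc n ⟦ a ⟧) (trans (∑-cong allHeads step) (sym (paths-suc n a)))
  where
  step : ∀ h → (if headAdmissible ⟦ a ⟧ h (suc n) then admissibleCount n (shift ⟦ a ⟧ h) else 0)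
             ≡ (if headAdmissible ⟦ a ⟧ h (suc n) then paths n (next a h) else 0)
  step h with headAdmissible ⟦ a ⟧ h (suc n) in admissible
  ... | true  = trans (admissibleCount-≈ n (shift-⟦⟧ a h (∧-conicalˡ (headCoversCell₀ ⟦ a ⟧ h) (bridged ⟦ a ⟧ 0)
                        (∧-conicalʳ (headFits h (suc n)) _ admissible))))
                      (admissibleCount-⟦⟧ n (next a h))
  ... | false = refl

μ≡paths : ∀ l → μ l ≡ paths l start
μ≡paths l = trans (μ≡admissibleCount l) (trans (admissibleCount-≈ l leftEnd≈⟦start⟧) (admissibleCount-⟦⟧ l start))

IsTribonacci : (ℕ → ℕ) → Set
IsTribonacci u = ∀ n → u (3 + n) ≡ u (2 + n) + u (1 + n) + u n

tribonacci-unique : ∀ {u v} → IsTribonacci u → IsTribonacci v →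
                    u 0 ≡ v 0 → u 1 ≡ v 1 → u 2 ≡ v 2 → ∀ n → u n ≡ v n
tribonacci-unique {u} {v} u-trib v-trib e₀ e₁ e₂ n = proj₁ (agree n)
  where
  agree : ∀ n → u n ≡ v n × u (1 + n) ≡ v (1 + n) × u (2 + n) ≡ v (2 + n)
  agree zero    = e₀ , e₁ , e₂
  agree (suc n) with agree n
  ... | eₙ , eₙ₊₁ , eₙ₊₂ = eₙ₊₁ , eₙ₊₂ , trans (u-trib n) (trans (cong₂ _+_ (cong₂ _+_ eₙ₊₂ eₙ₊₁) eₙ) (sym (v-trib n)))

tribonacci-combination : ∀ {u v} c → IsTribonacci u → IsTribonacci v → IsTribonacci (λ n → c * (u n + v n))
tribonacci-combination {u} {v} c u-trib v-trib n = begin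
  c * (u (3 + n) + v (3 + n))
    ≡⟨ cong₂ (λ s t → c * (s + t)) (u-trib n) (v-trib n) ⟩
  c * ((u (2 + n) + u (1 + n) + u n) + (v (2 + n) + v (1 + n) + v n))
    ≡⟨ solve 7 (λ c a b d a′ b′ d′ → c :* ((a :+ b :+ d) :+ (a′ :+ b′ :+ d′))
                 := c :* (a :+ a′) :+ c :* (b :+ b′) :+ c :* (d :+ d′))
             refl c (u (2 + n)) (u (1 + n)) (u n) (v (2 + n)) (v (1 + n)) (v n) ⟩
  c * (u (2 + n) + v (2 + n)) + c * (u (1 + n) + v (1 + n)) + c * (u n + v n) ∎
  where
  open ≡-Reasoning
  open +-*-Solver

headFits-long : ∀ h m → headFits h (3 + m) ≡ true
headFits-long h m = allTypeSide-cong {q = λ _ _ → true} λ k s →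
  trans (cong (not (startsAt h k s) ∨_) (teeth-≤ k)) (∨-zeroʳ (not (startsAt h k s)))
  where
  teeth-≤ : ∀ k → (teeth k ≤ᵇ 3 + m) ≡ true
  teeth-≤ zero             = refl
  teeth-≤ (suc zero)       = refl
  teeth-≤ (suc (suc zero)) = refl

admissibleHead : State → Heads → Bool
admissibleHead a h = headCoversCell₀ ⟦ a ⟧ h ∧ bridged ⟦ a ⟧ 0

transfer : State → (State → ℕ) → ℕ
transfer a f = ∑[ h ← allHeads ] (if admissibleHead a h then f (next a h) else 0)

paths-transfer : ∀ m a → paths (3 + m) a ≡ transfer a (paths (2 + m))
paths-transfer m a = trans (paths-suc (2 + m) a) (∑-cong allHeads λ h →
  cong (λ b → if b then paths (2 + m) (next a h) else 0) (cong (_∧ admissibleHead a h) (headFits-long h m)))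

transfer-cong : ∀ a {f g} → (∀ h → f (next a h) ≡ g (next a h)) → transfer a f ≡ transfer a g
transfer-cong a f≗g = ∑-cong allHeads λ h → cong (λ t → if admissibleHead a h then t else 0) (f≗g h)

transfer-+ : ∀ a f g → transfer a (λ b → f b + g b) ≡ transfer a f + transfer a g
transfer-+ a f g = trans (∑-cong allHeads λ h → if-+ (admissibleHead a h) (f (next a h)) (g (next a h)))
                         (∑-+ allHeads (λ h → if admissibleHead a h then f (next a h) else 0)
                                       (λ h → if admissibleHead a h then g (next a h) else 0))
  where
  if-+ : ∀ b x y → (if b then x + y else 0) ≡ (if b then x else 0) + (if b then y else 0)
  if-+ true  x y = refl
  if-+ false x y = refl

paths-tribonacci-step : ∀ m a →
  (∀ h → paths (6 + m) (next a h) ≡ paths (5 + m) (next a h) + paths (4 + m) (next a h) + paths (3 + m) (next a h)) →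
  paths (7 + m) a ≡ paths (6 + m) a + paths (5 + m) a + paths (4 + m) a
paths-tribonacci-step m a successors = begin
  paths (7 + m) a
    ≡⟨ paths-transfer (4 + m) a ⟩
  transfer a (paths (6 + m))
    ≡⟨ transfer-cong a {paths (6 + m)} {λ b → p₅ b + p₄ b + p₃ b} successors ⟩
  transfer a (λ b → p₅ b + p₄ b + p₃ b)
    ≡⟨ transfer-+ a (λ b → p₅ b + p₄ b) p₃ ⟩
  transfer a (λ b → p₅ b + p₄ b) + transfer a p₃
    ≡⟨ cong (_+ transfer a p₃) (transfer-+ a p₅ p₄) ⟩
  transfer a p₅ + transfer a p₄ + transfer a p₃
    ≡⟨ sym (cong₂ _+_ (cong₂ _+_ (paths-transfer (3 + m) a) (paths-transfer (2 + m) a)) (paths-transfer (1 + m) a)) ⟩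
  paths (6 + m) a + paths (5 + m) a + paths (4 + m) a ∎
  where
  open ≡-Reasoning
  p₅ p₄ p₃ : State → ℕ
  p₅ = paths (5 + m)
  p₄ = paths (4 + m)
  p₃ = paths (3 + m)

∀-Bool? : {P : Bool → Set} → (∀ b → Dec (P b)) → Dec (∀ b → P b)
∀-Bool? P? = map′ (λ (p-true , p-false) → λ { true → p-true ; false → p-false })
                  (λ ∀P → ∀P true , ∀P false) (P? true ×-dec P? false)

opaque
  unfolding paths

  paths-interior-tribonacci₀ : ∀ a → atLeftEnd a ≡ false → paths 6 a ≡ paths 5 a + paths 4 a + paths 3 a
  paths-interior-tribonacci₀ (state o₀ o₁ false u₀ u₁ u₂) refl = from-yes
    (all? λ o₀ → all? λ o₁ → ∀-Bool? λ u₀ → ∀-Bool? λ u₁ → ∀-Bool? λ u₂ →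
       let a = state o₀ o₁ false u₀ u₁ u₂ in paths 6 a ≟ paths 5 a + paths 4 a + paths 3 a)
    o₀ o₁ u₀ u₁ u₂

  paths-start-1 : paths 1 start ≡ 0
  paths-start-1 = refl

  paths-start-2 : paths 2 start ≡ 2
  paths-start-2 = refl

  paths-start-3 : paths 3 start ≡ 8
  paths-start-3 = refl

  paths-start-4 : paths 4 start ≡ 12
  paths-start-4 = refl

  paths-start-5 : paths 5 start ≡ 24
  paths-start-5 = refl

  paths-start-6 : paths 6 start ≡ 44
  paths-start-6 = refl

paths-interior-isTribonacci : ∀ a → atLeftEnd a ≡ false → IsTribonacci (λ n → paths (3 + n) a)
paths-interior-isTribonacci a interior zero = paths-interior-tribonacci₀ a interior
paths-interior-isTribonacci a _ (suc n) = paths-tribonacci-step n a (λ h → paths-interior-isTribonacci (next a h) refl n)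

paths-start-isTribonacci : IsTribonacci (λ n → paths (4 + n) start)
paths-start-isTribonacci n = paths-tribonacci-step n start (λ h → paths-interior-isTribonacci (next start h) refl n)

formula-isTribonacci : IsTribonacci (λ n → 4 * (Trib (4 + n) + Trib (3 + n)))
formula-isTribonacci = tribonacci-combination {λ n → Trib (4 + n)} {λ n → Trib (3 + n)} 4 (λ _ → refl) (λ _ → refl)

lemma3 : (l : ℕ) → 1 ≤ l → μ l ≡ 4 * (Trib l + Trib (l ∸ 1)) ∸ 2 * δ l 2
lemma3 0 ()
lemma3 1 _ = trans (μ≡paths 1) paths-start-1
lemma3 2 _ = trans (μ≡paths 2) paths-start-2
lemma3 3 _ = trans (μ≡paths 3) paths-start-3
lemma3 (suc (suc (suc (suc n)))) _ = trans (μ≡paths (4 + n))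
  (tribonacci-unique {λ m → paths (4 + m) start} {λ m → 4 * (Trib (4 + m) + Trib (3 + m))}
                     paths-start-isTribonacci formula-isTribonacci
                     paths-start-4 paths-start-5 paths-start-6 n)
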